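{- Let $H$ be a path consistent directed acyclic graph whose underlying undirected graph $H^{\mathrm{un}}$ is connected, let $u_*$ be a weight source of $H$ and let $w_{u_*}$ be the weight function with respect to $u_*$. Then: (1) $w_{u_*}(i)+1=w_{u_*}(j)$ for every edge $(i,j)\in E(H)$; (2) $w_{u_*}(i)\ge 0$ for all $i\in V(H)$, with equality if and only if $i$ is a weight source; (3) if $u_*'$ is another weight source then $w_{u_*}=w_{u_*'}$.
   Context: For an undirected path in $H^{\mathrm{un}}$ from $u$ to $v$, its signed length is the number of edges traversed (going from $u$ to $v$) in the direction of the corresponding directed edge of $H$ minus the number traversed against it. $H$ is path consistent if for all $u,v$, all undirected paths from $u$ to $v$ in $H^{\mathrm{un}}$ have the same signed length, denoted $\ell_{uv}$. A vertex $u_*$ is a weight source if there is $v_*$ with $\ell_{u_*v_*}=\max_{u,v}\ell_{uv}$. The weight function with respect to $u_*$ is $w_{u_*}(i)=\ell_{u_*i}$. -}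

module Defs where

open import Data.Nat using (ℕ)
open import Data.Fin using (Fin)
open import Data.Integer using (ℤ; _+_; _-_; _≤_; 0ℤ; 1ℤ)
open import Data.Product using (Σ; _×_)
open import Relation.Nullary using (¬_)
open import Relation.Binary.PropositionalEquality using (_≡_)
open import Level using (Level)

module _ {n : ℕ} (E : Fin n → Fin n → Set) where

  data DPath : Fin n → Fin n → Set where
    edge : ∀ {u v} → E u v → DPath u v
    step : ∀ {u w v} → E u w → DPath w v → DPath u v

  Acyclic : Set
  Acyclic = ∀ u → ¬ DPath u u

  -- Undirected paths (walks) in H^un from u to v; each step records whether
  -- the edge is traversed along (fwd) or against (bwd) its direction in H.
  data UPath : Fin n → Fin n → Set where
    nil : ∀ {u} → UPath u u
    fwd : ∀ {u w v} → E u w → UPath w v → UPath u v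
    bwd : ∀ {u w v} → E w u → UPath w v → UPath u v

  slen : ∀ {u v} → UPath u v → ℤ
  slen nil       = 0ℤ
  slen (fwd _ p) = 1ℤ + slen p
  slen (bwd _ p) = slen p - 1ℤ

  Connected : Set
  Connected = ∀ u v → UPath u v

  PathConsistent : Set
  PathConsistent = ∀ {u v} (p q : UPath u v) → slen p ≡ slen q

  module _ (conn : Connected) where

    -- ℓ_{uv}: the signed length of (any, by path consistency) undirected path u → v.
    ℓ : Fin n → Fin n → ℤ
    ℓ u v = slen (conn u v)

    WeightSource : Fin n → Set
    WeightSource u* = Σ (Fin n) λ v* → ∀ u v → ℓ u v ≤ ℓ u* v*

    w : Fin n → Fin n → ℤ
    w u* i = ℓ u* i

module Submission where

-- Concatenating undirected paths adds signed lengths, so in a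
-- path consistent graph with connected H^un the function ℓ is additive:
-- ℓ a b + ℓ b c ≡ ℓ a c.  Hence ℓ a b ≡ ℓ a c - ℓ b c, and ℓ i j ≡ 1 along an
-- edge (i , j).  Now fix a weight source u* whose maximum is attained
-- at ℓ u* v*.  For every i, ℓ u* i ≡ ℓ u* v* - ℓ i v* ≥ 0 because ℓ u* v* is
-- maximal; if i is a weight source with maximum ℓ i v′ then
-- ℓ u* i ≡ ℓ u* v′ - ℓ i v′ ≤ 0, so ℓ u* i ≡ 0; conversely ℓ u* i ≡ 0 gives
-- ℓ i v* ≡ ℓ u* v*, so i is a weight source.  Finally, for two weight sources
-- ℓ u* i ≡ ℓ u* u*′ + ℓ u*′ i ≡ ℓ u*′ i.

open import Defs
open import Data.Nat using (ℕ)
open import Data.Fin using (Fin)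
open import Data.Integer using (ℤ; _+_; _-_; -_; _≤_; 0ℤ; 1ℤ)
open import Data.Integer.Properties as ℤ using ()
open import Algebra.Properties.AbelianGroup ℤ.+-0-abelianGroup using (//-rightDividesʳ)
open import Data.Product using (_×_; _,_)
open import Function.Bundles using (_⇔_; mk⇔)
open import Relation.Binary.PropositionalEquality
  using (_≡_; sym; trans; cong; subst; module ≡-Reasoning)

module Concatenation {n : ℕ} (E : Fin n → Fin n → Set) where

  _++_ : ∀ {u v x} → UPath E u v → UPath E v x → UPath E u x
  nil     ++ q = q
  fwd e p ++ q = fwd e (p ++ q)
  bwd e p ++ q = bwd e (p ++ q)

  slen-++ : ∀ {u v x} (p : UPath E u v) (q : UPath E v x)
          → slen E (p ++ q) ≡ slen E p + slen E q
  slen-++ nil       q = sym (ℤ.+-identityˡ (slen E q))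
  slen-++ (fwd e p) q = begin
    1ℤ + slen E (p ++ q)          ≡⟨ cong (1ℤ +_) (slen-++ p q) ⟩
    1ℤ + (slen E p + slen E q)    ≡⟨ ℤ.+-assoc 1ℤ (slen E p) (slen E q) ⟨
    1ℤ + slen E p + slen E q      ∎
    where open ≡-Reasoning
  slen-++ (bwd e p) q = begin
    slen E (p ++ q) - 1ℤ          ≡⟨ cong (_- 1ℤ) (slen-++ p q) ⟩
    slen E p + slen E q - 1ℤ      ≡⟨ ℤ.+-assoc (slen E p) (slen E q) _ ⟩
    slen E p + (slen E q - 1ℤ)    ≡⟨ cong (slen E p +_) (ℤ.+-comm (slen E q) _) ⟩
    slen E p + (- 1ℤ + slen E q)  ≡⟨ ℤ.+-assoc (slen E p) _ (slen E q) ⟨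
    slen E p - 1ℤ + slen E q      ∎
    where open ≡-Reasoning

module SignedDistance {n : ℕ} (E : Fin n → Fin n → Set)
                      (pc : PathConsistent E) (conn : Connected E) where

  open Concatenation E

  private
    L : Fin n → Fin n → ℤ
    L = ℓ E conn

  ℓ-additive : ∀ a b c → L a b + L b c ≡ L a c
  ℓ-additive a b c =
    trans (sym (slen-++ (conn a b) (conn b c))) (pc (conn a b ++ conn b c) (conn a c))

  ℓ-edge : ∀ {i j} → E i j → L i j ≡ 1ℤ
  ℓ-edge e = pc (conn _ _) (fwd e nil)

  ℓ-difference : ∀ a b c → L a b ≡ L a c - L b c
  ℓ-difference a b c = begin
    L a b                  ≡⟨ //-rightDividesʳ (L b c) (L a b) ⟨
    L a b + L b c - L b c  ≡⟨ cong (_- L b c) (ℓ-additive a b c) ⟩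
    L a c - L b c          ∎
    where open ≡-Reasoning

  ℓ-nonneg : ∀ {u i v} → L i v ≤ L u v → 0ℤ ≤ L u i
  ℓ-nonneg {u} {i} {v} le = subst (0ℤ ≤_) (sym (ℓ-difference u i v)) (ℤ.i≤j⇒0≤j-i le)

  ℓ-nonpos : ∀ {u i v} → L u v ≤ L i v → L u i ≤ 0ℤ
  ℓ-nonpos {u} {i} {v} le = subst (_≤ 0ℤ) (sym (ℓ-difference u i v)) (ℤ.i≤j⇒i-j≤0 le)

  source-nonneg : ∀ {u*} → WeightSource E conn u* → ∀ i → 0ℤ ≤ L u* i
  source-nonneg (v* , max) i = ℓ-nonneg (max i v*)

  source-level : ∀ {u* i} → WeightSource E conn u* → WeightSource E conn i → L u* i ≡ 0ℤ
  source-level {u*} {i} ws (v′ , max′) =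
    ℤ.≤-antisym (ℓ-nonpos (max′ u* v′)) (source-nonneg ws i)

  level-source : ∀ {u* i} → WeightSource E conn u* → L u* i ≡ 0ℤ → WeightSource E conn i
  level-source {u*} {i} (v* , max) zero = v* , λ u v → subst (L u v ≤_) same-max (max u v)
    where
    same-max : L u* v* ≡ L i v*
    same-max = begin
      L u* v*          ≡⟨ ℓ-additive u* i v* ⟨
      L u* i + L i v*  ≡⟨ cong (_+ L i v*) zero ⟩
      0ℤ + L i v*      ≡⟨ ℤ.+-identityˡ (L i v*) ⟩
      L i v*           ∎
      where open ≡-Reasoning

  source-unique : ∀ {u* u*′} → WeightSource E conn u* → WeightSource E conn u*′
                → ∀ i → L u* i ≡ L u*′ i
  source-unique {u*} {u*′} ws ws′ i = begin
    L u* i                ≡⟨ ℓ-additive u* u*′ i ⟨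
    L u* u*′ + L u*′ i    ≡⟨ cong (_+ L u*′ i) (source-level ws ws′) ⟩
    0ℤ + L u*′ i          ≡⟨ ℤ.+-identityˡ (L u*′ i) ⟩
    L u*′ i               ∎
    where open ≡-Reasoning

proposition3p13 : (n : ℕ) (E : Fin n → Fin n → Set)
    → Acyclic E → PathConsistent E → (conn : Connected E)
    → (u* : Fin n) → WeightSource E conn u*
    → (∀ i j → E i j → w E conn u* i + 1ℤ ≡ w E conn u* j)
    × (∀ i → 0ℤ ≤ w E conn u* i)
    × (∀ i → (w E conn u* i ≡ 0ℤ) ⇔ WeightSource E conn i)
    × (∀ u*′ → WeightSource E conn u*′ → ∀ i → w E conn u* i ≡ w E conn u*′ i)
proposition3p13 n E _ pc conn u* ws =
    edge-step
  , source-nonneg ws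
  , (λ i → mk⇔ (level-source ws) (source-level ws))
  , (λ u*′ ws′ → source-unique ws ws′)
  where
  open SignedDistance E pc conn

  edge-step : ∀ i j → E i j → ℓ E conn u* i + 1ℤ ≡ ℓ E conn u* j
  edge-step i j e = trans (cong (ℓ E conn u* i +_) (sym (ℓ-edge e))) (ℓ-additive u* i j)
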